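{- Let $\mathcal{N}$ be a finite undirected graph and let $\mathcal{I}=\mathcal{N}.\omega$ be an irreducible version of it obtained by the reduction process. If $y$ is a node of $\mathcal{I}$ that is not isolated in $\mathcal{I}$, then either (1) there exists a chordless cycle $C$ in $\mathcal{I}$ of length $k\geq 4$ with $y\in C$, or (2) there exist chordless cycles $C_1,C_2$ in $\mathcal{I}$, each of length $\geq 4$, and nodes $x\in C_1$, $z\in C_2$ such that $y$ lies on a path from $x$ to $z$.
   Context: For a set $Y$ of nodes of a graph, $Y.\eta=\{z\notin Y : \exists y\in Y,\ (y,z)\text{ is an edge}\}$ and $Y.\rho=Y\cup Y.\eta$. A node $z$ is subsumed by a node $y\neq z$ if $z\in\{y\}.\eta$ and $\{z\}.\eta\subseteq\{y\}.\rho$. The reduction process $\omega$ repeatedly deletes (with incident edges) a node subsumed by another node of the current graph, until no node is subsumed; the result is $\mathcal{N}.\omega$. A cycle is a closed simple path $\langle y_1,\dots,y_k,y_1\rangle$ of length $k$; a chord is an edge $(y_i,y_j)$ between two cycle nodes that are not consecutive on the cycle; a cycle is chordless if it has no chord. -}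

module Defs where

open import Data.Nat using (ℕ; zero; suc; _≤_)
open import Data.Fin using (Fin; toℕ)
open import Data.Fin.Subset using (Subset; _∈_; _∉_; ⁅_⁆; _-_; ⊤)
open import Data.Bool using (Bool; T)
open import Data.Product using (Σ; ∃; _×_; _,_)
open import Data.Sum using (_⊎_)
open import Relation.Nullary using (¬_)
open import Relation.Binary.PropositionalEquality using (_≡_; _≢_)
open import Relation.Binary.Construct.Closure.ReflexiveTransitive using (Star)
open import Function.Definitions using (Injective)

record Graph : Set where
  field
    size  : ℕ
    adj   : Fin size → Fin size → Bool
    sym   : ∀ x y → T (adj x y) → T (adj y x)
    irrefl : ∀ x → ¬ T (adj x x)

  Node : Set
  Node = Fin size

  E : Node → Node → Set
  E x y = T (adj x y)

  -- Every graph arising in the reduction process is the subgraph of the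
  -- original graph induced by the set S of surviving nodes.

  η : Subset size → Subset size → Node → Set
  η S Y z = z ∈ S × z ∉ Y × ∃ λ y → y ∈ Y × E y z

  ρ : Subset size → Subset size → Node → Set
  ρ S Y z = z ∈ Y ⊎ η S Y z

  Subsumed : Subset size → Node → Node → Set
  Subsumed S z y =
    y ∈ S × z ∈ S × y ≢ z × η S ⁅ y ⁆ z ×
    (∀ w → η S ⁅ z ⁆ w → ρ S ⁅ y ⁆ w)

  Step : Subset size → Subset size → Set
  Step S S′ = ∃ λ z → ∃ λ y → Subsumed S z y × S′ ≡ S - z

  Irreducible : Subset size → Set
  Irreducible S = ∀ z y → ¬ Subsumed S z y

  IsReduction : Subset size → Set
  IsReduction S = Star Step ⊤ S × Irreducible S

  Consec : (k : ℕ) → Fin k → Fin k → Set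
  Consec k i j = (suc (toℕ i) ≡ toℕ j) ⊎ (suc (toℕ i) ≡ k × toℕ j ≡ 0)

  IsCycle : Subset size → (k : ℕ) → (Fin k → Node) → Set
  IsCycle S k c =
    3 ≤ k × Injective _≡_ _≡_ c × (∀ i → c i ∈ S) ×
    (∀ i j → Consec k i j → E (c i) (c j))

  Chordless : (k : ℕ) → (Fin k → Node) → Set
  Chordless k c =
    ∀ i j → i ≢ j → ¬ Consec k i j → ¬ Consec k j i → ¬ E (c i) (c j)

  ChordlessCycle≥4 : Subset size → (k : ℕ) → (Fin k → Node) → Set
  ChordlessCycle≥4 S k c = IsCycle S k c × Chordless k c × 4 ≤ k

  OnCycle : (k : ℕ) → (Fin k → Node) → Node → Set
  OnCycle k c y = ∃ λ i → c i ≡ y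

  IsPath : Subset size → (m : ℕ) → (Fin (suc m) → Node) → Set
  IsPath S m p =
    Injective _≡_ _≡_ p × (∀ i → p i ∈ S) ×
    (∀ i j → suc (toℕ i) ≡ toℕ j → E (p i) (p j))

  OnPathBetween : Subset size → Node → Node → Node → Set
  OnPathBetween S y x z =
    ∃ λ m → Σ (Fin (suc m) → Node) λ p →
      IsPath S m p × (∃ λ i → toℕ i ≡ 0 × p i ≡ x)
                   × (∃ λ i → toℕ i ≡ m × p i ≡ z)
                   × (∃ λ i → p i ≡ y)

  NonIsolated : Subset size → Node → Set
  NonIsolated S y = y ∈ S × ∃ λ w → w ∈ S × E y w

NodeSeq : (N : Graph) → ℕ → Set
NodeSeq N k = Fin k → Graph.Node N

-- In an irreducible graph no node z is subsumed by a neighbour y, so z has a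
-- private neighbour w with respect to y: adjacent to z, but neither equal nor
-- adjacent to y.  Hence an induced path p 0, …, p m can always be pushed on at
-- p 0, using a private neighbour w of p 0 with respect to p 1: if w has no other
-- neighbour on the path then w, p 0, …, p m is again induced; otherwise w closes
-- a chordless cycle w, p 0, …, p i of length at least 4, where p i is the first
-- neighbour of w after p 0.  Induced paths cannot outgrow the graph, so every
-- induced path prolongs to one starting on a chordless cycle of length ≥ 4.
-- Doing this to an edge at y, and then to the reverse of the result, yields a
-- path through y joining two such cycles: the second alternative always holds.

module Submission where

open import Defs
open import Data.Nat using (ℕ; zero; suc; _+_; _∸_; _≤_; _<_; z≤n; s≤s)
open import Data.Nat.Properties
  using (≤-refl; ≤-trans; ≤-pred; <⇒≤; ≤⇒≯; ≤∧≢⇒<; <-cmp; n<1+n; suc-injective;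
         m<n⇒m<1+n; m<1+n⇒m<n∨m≡n; m≤n⇒m≤1+n; m≤n+m; +-identityʳ; +-suc; +-monoʳ-≤;
         +-∸-assoc; m∸n≤m; n∸n≡0; ∸-monoʳ-<; ∸-cancelˡ-≡)
open import Data.Fin using (Fin; toℕ; fromℕ<)
  renaming (zero to fzero; suc to fsuc; _≟_ to _≟ᶠ_)
open import Data.Fin.Properties
  using (toℕ-injective; toℕ≤pred[n]; toℕ-fromℕ<; any?; injective⇒≤)
open import Data.Fin.Subset using (Subset; _∈_; _∉_; ⁅_⁆)
open import Data.Fin.Subset.Properties using (x∈⁅x⁆; x∈⁅y⁆⇒x≡y; _∈?_)
open import Data.Bool.Properties using (T?)
open import Data.Product using (Σ; ∃; _×_; _,_)
open import Data.Sum using (_⊎_; inj₁; inj₂; [_,_]′)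
open import Data.Empty using (⊥-elim)
open import Function using (_∘_)
open import Relation.Nullary using (¬_; Dec; yes; no)
open import Relation.Nullary.Decidable using (_×-dec_; ¬?)
open import Relation.Binary.PropositionalEquality
  using (_≡_; _≢_; refl; sym; trans; cong; subst; subst₂)
open import Relation.Binary.Definitions using (tri<; tri≈; tri>)

first? : {P : ℕ → Set} → (∀ j → Dec (P j)) → ∀ n →
  (∀ {j} → j < n → ¬ P j) ⊎ ∃ λ i → i < n × P i × (∀ {j} → j < i → ¬ P j)
first? P? zero = inj₁ λ ()
first? P? (suc n) with first? P? n
... | inj₂ (i , i<n , Pi , before) = inj₂ (i , m<n⇒m<1+n i<n , Pi , before)
... | inj₁ none with P? n
...   | yes Pn = inj₂ (n , n<1+n n , Pn , none)
...   | no ¬Pn = inj₁ λ j<1+n → [ none , (λ { refl → ¬Pn }) ]′ (m<1+n⇒m<n∨m≡n j<1+n)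

module InducedPaths (N : Graph) (S : Subset (Graph.size N)) where
  open Graph N renaming (sym to E-sym)

  record InducedPath (m : ℕ) (p : ℕ → Node) : Set where
    field
      ∈S        : ∀ {t} → t ≤ m → p t ∈ S
      injective : ∀ {a b} → a ≤ m → b ≤ m → p a ≡ p b → a ≡ b
      edge      : ∀ {t} → suc t ≤ m → E (p t) (p (suc t))
      no-chord  : ∀ {a b} → b ≤ m → suc a < b → ¬ E (p a) (p b)

  open InducedPath

  module _ {m : ℕ} {p : ℕ → Node} (P : InducedPath m p) where

    non-adjacent : ∀ {a b} → a ≤ m → b ≤ m → a ≢ b → suc a ≢ b → suc b ≢ a →
                   ¬ E (p a) (p b)
    non-adjacent {a} {b} a≤m b≤m a≢b a+1≢b b+1≢a with <-cmp a b
    ... | tri< a<b _ _ = no-chord P b≤m (≤∧≢⇒< a<b a+1≢b)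
    ... | tri≈ _ a≡b _ = λ _ → a≢b a≡b
    ... | tri> _ _ b<a = no-chord P a≤m (≤∧≢⇒< b<a b+1≢a) ∘ E-sym _ _

    length<size : m < size
    length<size = injective⇒≤ {f = λ (j : Fin (suc m)) → p (toℕ j)}
      λ {a} {b} e → toℕ-injective (injective P (toℕ≤pred[n] a) (toℕ≤pred[n] b) e)

    take : ∀ {ℓ} → ℓ ≤ m → InducedPath ℓ p
    take ℓ≤m = record
      { ∈S        = λ t≤ℓ → ∈S P (≤-trans t≤ℓ ℓ≤m)
      ; injective = λ a≤ℓ b≤ℓ → injective P (≤-trans a≤ℓ ℓ≤m) (≤-trans b≤ℓ ℓ≤m)
      ; edge      = λ t<ℓ → edge P (≤-trans t<ℓ ℓ≤m)
      ; no-chord  = λ b≤ℓ → no-chord P (≤-trans b≤ℓ ℓ≤m)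
      }

    reverse : InducedPath m (λ t → p (m ∸ t))
    reverse = record
      { ∈S        = λ {t} _ → ∈S P (m∸n≤m m t)
      ; injective = λ {a} {b} a≤m b≤m e →
                      ∸-cancelˡ-≡ a≤m b≤m (injective P (m∸n≤m m a) (m∸n≤m m b) e)
      ; edge      = λ {t} t<m →
                      subst (λ u → E (p u) (p (m ∸ suc t))) (sym (m∸t≡1+m∸[1+t] t<m))
                        (E-sym _ _ (edge P (subst (_≤ m) (m∸t≡1+m∸[1+t] t<m) (m∸n≤m m t))))
      ; no-chord  = λ {a} {b} b≤m a+1<b → no-chord P (m∸n≤m m a)
                      (subst (suc (suc (m ∸ b)) ≤_) (sym (m∸t≡1+m∸[1+t] (≤-trans (<⇒≤ a+1<b) b≤m)))
                        (s≤s (∸-monoʳ-< a+1<b b≤m)))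
                      ∘ E-sym _ _
      }
      where
      m∸t≡1+m∸[1+t] : ∀ {t} → t < m → m ∸ t ≡ suc (m ∸ suc t)
      m∸t≡1+m∸[1+t] = +-∸-assoc 1

    on-path : ∀ {t} → t ≤ m → OnPathBetween S (p t) (p 0) (p m)
    on-path {t} t≤m =
      m , (p ∘ toℕ) ,
      ( (λ {a} {b} e → toℕ-injective (injective P (toℕ≤pred[n] a) (toℕ≤pred[n] b) e))
      , (λ j → ∈S P (toℕ≤pred[n] j))
      , (λ i j e → subst (E (p (toℕ i)) ∘ p) e (edge P (subst (_≤ m) (sym e) (toℕ≤pred[n] j)))) ) ,
      (fzero , refl , refl) ,
      (fromℕ< (n<1+n m) , toℕ-fromℕ< (n<1+n m) , cong p (toℕ-fromℕ< (n<1+n m))) ,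
      (fromℕ< (s≤s t≤m) , cong p (toℕ-fromℕ< (s≤s t≤m)))

    fresh-neighbour : ∀ {w} → E (p 0) w → w ≢ p 1 → ∀ {t} → t ≤ m → p t ≢ w
    fresh-neighbour p₀w w≢p₁ {zero}        _   refl = irrefl _ p₀w
    fresh-neighbour p₀w w≢p₁ {suc zero}    _   p₁≡w = w≢p₁ (sym p₁≡w)
    fresh-neighbour p₀w w≢p₁ {suc (suc t)} t≤m refl = no-chord P t≤m (s≤s (s≤s z≤n)) p₀w

  single : ∀ {y} → y ∈ S → InducedPath 0 (λ _ → y)
  single y∈S = record
    { ∈S        = λ _ → y∈S
    ; injective = λ { z≤n z≤n _ → refl }
    ; edge      = λ ()
    ; no-chord  = λ { z≤n () }
    }

  _◂_ : Node → (ℕ → Node) → ℕ → Node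
  (w ◂ p) zero    = w
  (w ◂ p) (suc t) = p t

  ◂-induced : ∀ {m p w} → InducedPath m p → w ∈ S → (∀ {t} → t ≤ m → p t ≢ w) →
              E w (p 0) → (∀ {t} → 0 < t → t ≤ m → ¬ E w (p t)) →
              InducedPath (suc m) (w ◂ p)
  ◂-induced {m} {p} {w} P w∈S fresh wp₀ far = record
    { ∈S = λ { {zero} _ → w∈S ; {suc t} (s≤s t≤m) → ∈S P t≤m }
    ; injective = injective′
    ; edge = λ { {zero} _ → wp₀ ; {suc t} (s≤s t<m) → edge P t<m }
    ; no-chord = no-chord′
    }
    where
    injective′ : ∀ {a b} → a ≤ suc m → b ≤ suc m → (w ◂ p) a ≡ (w ◂ p) b → a ≡ b
    injective′ {zero}  {zero}  _         _         _ = refl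
    injective′ {zero}  {suc b} _         (s≤s b≤m) e = ⊥-elim (fresh b≤m (sym e))
    injective′ {suc a} {zero}  (s≤s a≤m) _         e = ⊥-elim (fresh a≤m e)
    injective′ {suc a} {suc b} (s≤s a≤m) (s≤s b≤m) e = cong suc (injective P a≤m b≤m e)

    no-chord′ : ∀ {a b} → b ≤ suc m → suc a < b → ¬ E ((w ◂ p) a) ((w ◂ p) b)
    no-chord′ {zero}  {suc b} (s≤s b≤m) (s≤s 1<1+b) = far 1<1+b b≤m
    no-chord′ {suc a} {suc b} (s≤s b≤m) (s≤s a+1<b) = no-chord P b≤m a+1<b

  ChordlessCycleThrough : Node → Set
  ChordlessCycleThrough x =
    ∃ λ k → Σ (NodeSeq N k) λ C → ChordlessCycle≥4 S k C × OnCycle k C x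

  closing-cycle : ∀ {ℓ p w} → InducedPath ℓ p → 2 ≤ ℓ → w ∈ S →
                  (∀ {t} → t ≤ ℓ → p t ≢ w) → E w (p 0) → E (p ℓ) w →
                  (∀ {t} → 0 < t → t < ℓ → ¬ E w (p t)) →
                  ChordlessCycle≥4 S (suc (suc ℓ)) ((w ◂ p) ∘ toℕ)
  closing-cycle {ℓ} {p} {w} P 2≤ℓ w∈S fresh wp₀ pℓw interior =
    (s≤s (m≤n⇒m≤1+n 2≤ℓ) , injective′ , ∈S′ , edge′) , chordless , s≤s (s≤s 2≤ℓ)
    where
    k = suc (suc ℓ)
    C = (w ◂ p) ∘ toℕ

    ∈S′ : ∀ j → C j ∈ S
    ∈S′ fzero    = w∈S
    ∈S′ (fsuc j) = ∈S P (toℕ≤pred[n] j)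

    injective′ : ∀ {i j} → C i ≡ C j → i ≡ j
    injective′ {fzero}  {fzero}  _ = refl
    injective′ {fzero}  {fsuc j} e = ⊥-elim (fresh (toℕ≤pred[n] j) (sym e))
    injective′ {fsuc i} {fzero}  e = ⊥-elim (fresh (toℕ≤pred[n] i) e)
    injective′ {fsuc i} {fsuc j} e =
      cong fsuc (toℕ-injective (injective P (toℕ≤pred[n] i) (toℕ≤pred[n] j) e))

    edge′ : ∀ i j → Consec k i j → E (C i) (C j)
    edge′ fzero    fzero    (inj₁ ())
    edge′ fzero    fzero    (inj₂ (() , _))
    edge′ fzero    (fsuc j) (inj₁ e) = subst (E w ∘ p) (suc-injective e) wp₀
    edge′ fzero    (fsuc j) (inj₂ (() , _))
    edge′ (fsuc i) fzero    (inj₁ ())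
    edge′ (fsuc i) fzero    (inj₂ (e , _)) =
      subst (λ u → E (p u) w) (sym (suc-injective (suc-injective e))) pℓw
    edge′ (fsuc i) (fsuc j) (inj₁ e) =
      subst (E (p (toℕ i)) ∘ p) (suc-injective e)
        (edge P (subst (_≤ ℓ) (sym (suc-injective e)) (toℕ≤pred[n] j)))
    edge′ (fsuc i) (fsuc j) (inj₂ (_ , ()))

    w-no-chord : ∀ j → ¬ Consec k fzero (fsuc j) → ¬ Consec k (fsuc j) fzero → ¬ E w (p (toℕ j))
    w-no-chord j ¬w→j ¬j→w = interior
      (≤∧≢⇒< z≤n (λ 0≡j → ¬w→j (inj₁ (cong suc 0≡j))))
      (≤∧≢⇒< (toℕ≤pred[n] j) (λ j≡ℓ → ¬j→w (inj₂ (cong (suc ∘ suc) j≡ℓ , refl))))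

    chordless : Chordless k C
    chordless fzero    fzero    i≢j _ _ = ⊥-elim (i≢j refl)
    chordless fzero    (fsuc j) _ ¬i→j ¬j→i = w-no-chord j ¬i→j ¬j→i
    chordless (fsuc i) fzero    _ ¬i→j ¬j→i = w-no-chord i ¬j→i ¬i→j ∘ E-sym _ _
    chordless (fsuc i) (fsuc j) i≢j ¬i→j ¬j→i = non-adjacent P (toℕ≤pred[n] i) (toℕ≤pred[n] j)
      (i≢j ∘ cong fsuc ∘ toℕ-injective)
      (λ e → ¬i→j (inj₁ (cong suc e)))
      (λ e → ¬j→i (inj₁ (cong suc e)))

  private-neighbour : Irreducible S → ∀ {z y} → z ∈ S → y ∈ S → E z y →
                      ∃ λ w → w ∈ S × E z w × w ≢ y × ¬ E y w
  private-neighbour irr {z} {y} z∈S y∈S zy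
    with any? (λ w → (w ∈? S) ×-dec T? (adj z w) ×-dec ¬? (w ≟ᶠ y) ×-dec ¬? (T? (adj y w)))
  ... | yes found = found
  ... | no none =
    ⊥-elim (irr z y (y∈S , z∈S , y≢z , (z∈S , z∉⁅y⁆ , y , x∈⁅x⁆ y , E-sym _ _ zy) , dominated))
    where
    y≢z : y ≢ z
    y≢z refl = irrefl y zy
    z∉⁅y⁆ : z ∉ ⁅ y ⁆
    z∉⁅y⁆ = y≢z ∘ sym ∘ x∈⁅y⁆⇒x≡y y
    dominated : ∀ v → η S ⁅ z ⁆ v → ρ S ⁅ y ⁆ v
    dominated v (v∈S , _ , z′ , z′∈⁅z⁆ , z′v) with v ≟ᶠ y | T? (adj y v)
    ... | yes refl | _      = inj₁ (x∈⁅x⁆ y)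
    ... | no v≢y   | yes yv = inj₂ (v∈S , v≢y ∘ x∈⁅y⁆⇒x≡y y , y , x∈⁅x⁆ y , yv)
    ... | no v≢y   | no ¬yv =
      ⊥-elim (none (v , v∈S , subst (λ u → E u v) (x∈⁅y⁆⇒x≡y z z′∈⁅z⁆) z′v , v≢y , ¬yv))

  record Prolongation (m : ℕ) (p : ℕ → Node) : Set where
    field
      n       : ℕ
      q       : ℕ → Node
      induced : InducedPath (n + m) q
      suffix  : ∀ {t} → t ≤ m → q (n + t) ≡ p t
      cycle   : ChordlessCycleThrough (q 0)

  module _ (irr : Irreducible S) where

    close-or-extend : ∀ {m p} → 0 < m → InducedPath m p →
                      ChordlessCycleThrough (p 0) ⊎ ∃ λ w → InducedPath (suc m) (w ◂ p)
    close-or-extend {m} {p} 0<m P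
      with w , w∈S , p₀w , w≢p₁ , ¬p₁w ← private-neighbour irr (∈S P z≤n) (∈S P 0<m) (edge P 0<m)
      with first? (λ j → T? (adj w (p (suc j)))) m
    ... | inj₂ (zero , _ , wp₁ , _) = ⊥-elim (¬p₁w (E-sym _ _ wp₁))
    ... | inj₂ (suc i , ℓ≤m , wpℓ , before) = inj₁
      ( _ , _
      , closing-cycle (take P ℓ≤m) (s≤s (s≤s z≤n)) w∈S (λ t≤ℓ → fresh (≤-trans t≤ℓ ℓ≤m))
                      (E-sym _ _ p₀w) (E-sym _ _ wpℓ) (λ { {suc j} _ j<ℓ → before (≤-pred j<ℓ) })
      , fsuc fzero , refl )
      where
      fresh : ∀ {t} → t ≤ m → p t ≢ w
      fresh = fresh-neighbour P p₀w w≢p₁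
    ... | inj₁ none = inj₂
      (w , ◂-induced P w∈S (fresh-neighbour P p₀w w≢p₁) (E-sym _ _ p₀w)
                     λ { {suc j} _ j<m → none j<m })

    prolong : ∀ fuel {m p} → size ≤ m + fuel → 0 < m → InducedPath m p → Prolongation m p
    prolong zero {m} size≤m _ P =
      ⊥-elim (≤⇒≯ (subst (size ≤_) (+-identityʳ m) size≤m) (length<size P))
    prolong (suc fuel) {m} {p} size≤ 0<m P with close-or-extend 0<m P
    ... | inj₁ cycle = record { n = 0 ; q = p ; induced = P ; suffix = λ _ → refl ; cycle = cycle }
    ... | inj₂ (w , P′) = record
      { n       = suc n
      ; q       = q
      ; induced = subst (λ ℓ → InducedPath ℓ q) (+-suc n m) induced
      ; suffix  = λ {t} t≤m → trans (cong q (sym (+-suc n t))) (suffix (s≤s t≤m))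
      ; cycle   = cycle
      }
      where open Prolongation (prolong fuel (subst (size ≤_) (+-suc m fuel) size≤) (s≤s z≤n) P′)

proposition4 : (N : Graph) → let open Graph N in
    (I : Subset size) → IsReduction I →
    (y : Node) → NonIsolated I y →
    (∃ λ k → Σ (NodeSeq N k) λ C → ChordlessCycle≥4 I k C × OnCycle k C y)
    ⊎
    (∃ λ k₁ → Σ (NodeSeq N k₁) λ C₁ → ∃ λ k₂ → Σ (NodeSeq N k₂) λ C₂ →
    ChordlessCycle≥4 I k₁ C₁ × ChordlessCycle≥4 I k₂ C₂ ×
    ∃ λ x → ∃ λ z → OnCycle k₁ C₁ x × OnCycle k₂ C₂ z ×
    OnPathBetween I y x z)
proposition4 N I (_ , irr) y (y∈I , w , w∈I , yw) =
  let k₁ , C₁ , cc₁ , on₁ = first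
      k₂ , C₂ , cc₂ , on₂ = second
  in inj₂ (k₂ , C₂ , k₁ , C₁ , cc₂ , cc₁ , q₂ 0 , q₁ 0 , on₂ , on₁ ,
           subst₂ (λ u v → OnPathBetween I u (q₂ 0) v) through-y ends-on-first
                  (on-path induced₂ (+-monoʳ-≤ n₂ z≤n)))
  where
  open Graph N renaming (sym to E-sym)
  open InducedPaths N I
  edge-path : InducedPath 1 (w ◂ λ _ → y)
  edge-path = ◂-induced (single y∈I) w∈I (λ { z≤n refl → irrefl y yw }) (E-sym _ _ yw)
                        λ { (s≤s _) () }
  open Prolongation (prolong irr size (m≤n+m size 1) (s≤s z≤n) edge-path)
    renaming (n to n₁; q to q₁; induced to induced₁; suffix to suffix₁; cycle to first)
  open Prolongation (prolong irr size (m≤n+m size (n₁ + 1)) (m≤n+m 1 n₁) (reverse induced₁))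
    renaming (n to n₂; q to q₂; induced to induced₂; suffix to suffix₂; cycle to second)
  through-y : q₂ (n₂ + 0) ≡ y
  through-y = trans (suffix₂ z≤n) (suffix₁ (s≤s z≤n))
  ends-on-first : q₂ (n₂ + (n₁ + 1)) ≡ q₁ 0
  ends-on-first = trans (suffix₂ ≤-refl) (cong q₁ (n∸n≡0 (n₁ + 1)))
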